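{- For all integers $n,m\ge 2$, \[ \gamma_{2t}(K_n\Box K_m)+1\le \gamma_{2t}(K_{n+1}\Box K_{m+1})\le \gamma_{2t}(K_n\Box K_m)+2. \]
   Context: $K_n$ denotes the complete graph on $n$ vertices. The Cartesian product $G\Box H$ has vertex set $V(G)\times V(H)$, with $(u_1,v_1)\sim(u_2,v_2)$ iff either $u_1=u_2$ and $v_1\sim v_2$, or $v_1=v_2$ and $u_1\sim u_2$. A set $S$ of vertices of a graph $G$ is total $2$-dominating if every vertex of $G$ is adjacent to at least two vertices of $S$; $\gamma_{2t}(G)$ is the minimum cardinality of such a set. -}

module Defs where

open import Data.Nat using (ℕ; _≤_; _+_)
open import Data.Bool using (Bool; true; false)
open import Data.Fin using (Fin)
open import Data.Fin.Properties using (_≟_)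
open import Data.Product using (_×_; _,_; Σ)
open import Data.Sum using (_⊎_)
open import Data.List using (List; length; filter; allFin; cartesianProduct)
open import Relation.Binary.PropositionalEquality using (_≡_)
open import Relation.Nullary using (¬_; Dec; yes; no)
open import Relation.Nullary.Decidable using (_×-dec_; _⊎-dec_; ¬?)
open import Relation.Unary using (Pred)

Vertex : ℕ → ℕ → Set
Vertex n m = Fin n × Fin m

Adj : ∀ {n m} → Vertex n m → Vertex n m → Set
Adj (u₁ , v₁) (u₂ , v₂) = (u₁ ≡ u₂ × ¬ v₁ ≡ v₂) ⊎ (v₁ ≡ v₂ × ¬ u₁ ≡ u₂)

adj? : ∀ {n m} (x y : Vertex n m) → Dec (Adj x y)
adj? (u₁ , v₁) (u₂ , v₂) = (u₁ ≟ u₂ ×-dec ¬? (v₁ ≟ v₂)) ⊎-dec (v₁ ≟ v₂ ×-dec ¬? (u₁ ≟ u₂))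

vertices : ∀ n m → List (Vertex n m)
vertices n m = cartesianProduct (allFin n) (allFin m)

VSet : ℕ → ℕ → Set
VSet n m = Vertex n m → Bool

member? : ∀ {n m} (S : VSet n m) (x : Vertex n m) → Dec (S x ≡ true)
member? S x with S x
... | true  = yes _≡_.refl
... | false = no (λ ())

card : ∀ {n m} → VSet n m → ℕ
card {n} {m} S = length (filter (member? S) (vertices n m))

degIn : ∀ {n m} → VSet n m → Vertex n m → ℕ
degIn {n} {m} S x =
  length (filter (λ y → adj? x y ×-dec member? S y) (vertices n m))

IsTotal2Dom : ∀ {n m} → VSet n m → Set
IsTotal2Dom {n} {m} S = (x : Vertex n m) → 2 ≤ degIn S x

IsGamma2t : ℕ → ℕ → ℕ → Set
IsGamma2t n m k =
  Σ (VSet n m) (λ S → IsTotal2Dom S × card S ≡ k)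
  × ((S : VSet n m) → IsTotal2Dom S → k ≤ card S)

module Submission where

-- A vertex set S of K_n □ K_m is an n × m Boolean matrix, and the neighbours of a vertex (i , j) in S
-- are the other points of S in row i and in column j. So S is total 2-dominating iff every cell
-- satisfies r_i + c_j ≥ 2 + 2[(i , j) ∈ S], with r_i, c_j the row and column counts.
--
-- Upper bound: a dominating n × m matrix extends to (n+1) × (m+1) by a new row and column carrying
-- at most two points: two points of one column if all columns are heavy (≥ 2 points), symmetrically
-- for rows, and otherwise one point each, placed in a heavy column and in a heavy row.
--
-- Lower bound: a dominating (n+1) × (m+1) matrix yields a dominating n × m one with fewer points. Two full
-- rows (or columns) of the n × m grid dominate with 2m (or 2n) points, so it suffices that the
-- big matrix has more points than that; this holds if all its rows or all its columns are heavy.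
-- Otherwise it has a leaf row r (one point, in column c) and a leaf column s (one point, in row q).
-- If (q , c) is empty, deleting row r and column c and moving column c into column s works.
-- If no such configuration exists, double counting shows that the big matrix has at least
-- n + m + 1 points, again more than 2 min(n , m).

open import Defs
open import Data.Nat using (ℕ; zero; suc; _≤_; _<_; _+_; _*_; z≤n; s≤s; _≤?_)
open import Data.Nat.Properties
  using (+-*-semiring; +-comm; +-identityʳ; *-zeroʳ; *-identityʳ; ≤-refl; ≤-trans; ≤-reflexive; module ≤-Reasoning;
         +-mono-≤; +-monoˡ-≤; +-monoʳ-≤; m≤m+n; m≤n+m; ≤-pred; ≰⇒>; +-cancelʳ-≤; n≤1+n)
import Data.Nat.Properties as ℕ
open import Data.Nat.Tactic.RingSolver using (solve-∀)
open import Data.Bool using (Bool; true; false; _∧_; _∨_)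
open import Data.Bool.Properties using (∨-zeroʳ; ¬-not; ∧-conicalˡ; ∧-conicalʳ)
import Data.Bool.Properties as Bool
open import Data.Fin using (Fin; zero; suc; punchIn; punchOut)
open import Data.Fin.Properties using (_≟_; punchIn-punchOut; punchInᵢ≢i; suc-injective; all?; any?; ¬∀⟶∃¬)
open import Data.Product using (Σ-syntax; ∃; _×_; _,_; proj₁; proj₂; curry; uncurry)
open import Data.Sum using (_⊎_; inj₁; inj₂)
import Data.Sum as Sum
open import Data.List using (length; filter; tabulate; map; _++_; cartesianProduct)
open import Data.List.Properties using (length-++; filter-++; map-tabulate)
open import Data.Vec.Functional using (transpose)
open import Function using (_∘_; case_of_)
open import Relation.Binary.PropositionalEquality
open import Relation.Nullary using (¬_; Dec; yes; no; does; _×-dec_)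
open import Relation.Nullary.Decidable using (dec-true; dec-false)
open import Relation.Unary using (Pred; Decidable)
open import Algebra.Properties.Semiring.Sum +-*-semiring
  using (sum; ∑-distrib-+; ∑-comm; sum-remove; *-distribˡ-sum; *-distribʳ-sum; sum-cong-≗)

toℕ : Bool → ℕ
toℕ true  = 1
toℕ false = 0

does≡true⇒ : ∀ {p} {P : Set p} (P? : Dec P) → does P? ≡ true → P
does≡true⇒ (yes p) _ = p

does≡false⇒ : ∀ {p} {P : Set p} (P? : Dec P) → does P? ≡ false → ¬ P
does≡false⇒ (no ¬p) _ = ¬p

toℕ-∨ : ∀ a b → toℕ (a ∨ b) ≤ toℕ a + toℕ b
toℕ-∨ true  b = s≤s z≤n
toℕ-∨ false b = ≤-refl

toℕ-∧ : ∀ a b → toℕ (a ∧ b) ≤ toℕ b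
toℕ-∧ true  b = ≤-refl
toℕ-∧ false b = z≤n

toℕ-∨-∧ : ∀ a e k → (a ≡ true → e ≡ true → k ≡ false) → toℕ (a ∨ (e ∧ k)) ≡ toℕ a + toℕ k * toℕ e
toℕ-∨-∧ true  true  true  disjoint with () ← disjoint refl refl
toℕ-∨-∧ true  true  false _ = refl
toℕ-∨-∧ true  false true  _ = refl
toℕ-∨-∧ true  false false _ = refl
toℕ-∨-∧ false true  true  _ = refl
toℕ-∨-∧ false true  false _ = refl
toℕ-∨-∧ false false true  _ = refl
toℕ-∨-∧ false false false _ = refl

2+2*x≤x+y+2 : ∀ {x y} → x ≤ y → 2 + 2 * x ≤ x + y + 2
2+2*x≤x+y+2 {x} {y} x≤y = subst (_≤ x + y + 2) (reshuffle x) (+-monoˡ-≤ 2 (+-monoʳ-≤ x x≤y))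
  where
  reshuffle : ∀ x → x + x + 2 ≡ 2 + 2 * x
  reshuffle = solve-∀

2≤n+[n≡1] : ∀ n → 1 ≤ n → 2 ≤ n + toℕ (does (n ℕ.≟ 1))
2≤n+[n≡1] (suc zero)    _ = ≤-refl
2≤n+[n≡1] (suc (suc n)) _ = s≤s (s≤s z≤n)

sum-mono-≤ : ∀ {n} {f g : Fin n → ℕ} → (∀ i → f i ≤ g i) → sum f ≤ sum g
sum-mono-≤ {zero}  f≤g = z≤n
sum-mono-≤ {suc n} f≤g = +-mono-≤ (f≤g zero) (sum-mono-≤ (f≤g ∘ suc))

sum-const : ∀ {n} k → sum {n} (λ _ → k) ≡ n * k
sum-const {zero}  k = refl
sum-const {suc n} k = cong (k +_) (sum-const {n} k)

sum-zero : ∀ {n} → sum {n} (λ _ → 0) ≡ 0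
sum-zero {n} = trans (sum-const {n} 0) (*-zeroʳ n)

δ : ∀ {n} → Fin n → Fin n → ℕ
δ i k = toℕ (does (i ≟ k))

∑-δ : ∀ {n} (k : Fin n) (f : Fin n → ℕ) → sum (λ i → δ k i * f i) ≡ f k
∑-δ {suc n} zero f = begin
  f zero + 0 + sum (λ i → 0 * f (suc i))  ≡⟨ cong (f zero + 0 +_) (sum-zero {n}) ⟩
  f zero + 0 + 0                          ≡⟨ +-identityʳ _ ⟩
  f zero + 0                              ≡⟨ +-identityʳ _ ⟩
  f zero                                  ∎
  where open ≡-Reasoning
∑-δ (suc k) f = ∑-δ k (f ∘ suc)

¬all-heavy⇒∃-light : ∀ {n} (w : Fin n → ℕ) → ¬ (∀ i → 2 ≤ w i) → ∃ λ i → w i ≤ 1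
¬all-heavy⇒∃-light {n} w ¬heavy with ¬∀⟶∃¬ n (λ i → 2 ≤ w i) (λ i → 2 ≤? w i) ¬heavy
... | i , ¬2≤wi = i , ≤-pred (≰⇒> ¬2≤wi)

count : ∀ {n} → (Fin n → Bool) → ℕ
count p = sum (toℕ ∘ p)

count-singleton : ∀ {n} (k : Fin n) → count (λ i → does (k ≟ i)) ≡ 1
count-singleton k = trans (sum-cong-≗ (λ i → sym (*-identityʳ (δ k i)))) (∑-δ k (λ _ → 1))

count-pair≤2 : ∀ {n} (k l : Fin n) → count (λ i → does (k ≟ i) ∨ does (l ≟ i)) ≤ 2
count-pair≤2 k l = begin
  count (λ i → does (k ≟ i) ∨ does (l ≟ i))
    ≤⟨ sum-mono-≤ (λ i → toℕ-∨ (does (k ≟ i)) (does (l ≟ i))) ⟩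
  sum (λ i → δ k i + δ l i)
    ≡⟨ ∑-distrib-+ (δ k) (δ l) ⟩
  count (λ i → does (k ≟ i)) + count (λ i → does (l ≟ i))
    ≡⟨ cong₂ _+_ (count-singleton k) (count-singleton l) ⟩
  2 ∎
  where open ≤-Reasoning

∈⇒1≤count : ∀ {n} (p : Fin n → Bool) {i} → p i ≡ true → 1 ≤ count p
∈⇒1≤count {suc n} p {i} pi≡true = begin
  1                                  ≡⟨ cong toℕ (sym pi≡true) ⟩
  toℕ (p i)                          ≤⟨ m≤m+n _ _ ⟩
  toℕ (p i) + count (p ∘ punchIn i)  ≡⟨ sym (sum-remove {i = i} (toℕ ∘ p)) ⟩
  count p                            ∎
  where open ≤-Reasoning

∈₂⇒2≤count : ∀ {n} (p : Fin n → Bool) {i j} → ¬ i ≡ j → p i ≡ true → p j ≡ true → 2 ≤ count p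
∈₂⇒2≤count {suc n} p {i} {j} i≢j pi≡true pj≡true = begin
  2                                  ≤⟨ s≤s (∈⇒1≤count (p ∘ punchIn i) p-punchOut) ⟩
  1 + count (p ∘ punchIn i)          ≡⟨ cong (λ b → toℕ b + count (p ∘ punchIn i)) (sym pi≡true) ⟩
  toℕ (p i) + count (p ∘ punchIn i)  ≡⟨ sym (sum-remove {i = i} (toℕ ∘ p)) ⟩
  count p                            ∎
  where
  open ≤-Reasoning
  p-punchOut : p (punchIn i (punchOut i≢j)) ≡ true
  p-punchOut = trans (cong p (punchIn-punchOut i≢j)) pj≡true

count≡1⇒unique : ∀ {n} (p : Fin n → Bool) {i j} → count p ≡ 1 → p i ≡ true → p j ≡ true → i ≡ j
count≡1⇒unique p {i} {j} count≡1 pi≡true pj≡true with i ≟ j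
... | yes i≡j = i≡j
... | no  i≢j with s≤s () ← subst (2 ≤_) count≡1 (∈₂⇒2≤count p i≢j pi≡true pj≡true)

1≤count⇒∃ : ∀ {n} (p : Fin n → Bool) → 1 ≤ count p → ∃ λ i → p i ≡ true
1≤count⇒∃ {suc n} p 1≤count with p zero in p0
... | true  = zero , p0
... | false = let (i , pi) = 1≤count⇒∃ (p ∘ suc) 1≤count in suc i , pi

2≤count⇒∃₂ : ∀ {n} (p : Fin n → Bool) → 2 ≤ count p →
             Σ[ i ∈ Fin n ] Σ[ j ∈ Fin n ] ¬ i ≡ j × p i ≡ true × p j ≡ true
2≤count⇒∃₂ {suc n} p 2≤count with p zero in p0
... | true  = let (j , pj) = 1≤count⇒∃ (p ∘ suc) (≤-pred 2≤count) in zero , suc j , (λ ()) , p0 , pj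
... | false = let (i , j , i≢j , pi , pj) = 2≤count⇒∃₂ (p ∘ suc) 2≤count in
              suc i , suc j , i≢j ∘ suc-injective , pi , pj

length-filter-tabulate : ∀ {a ℓ} {A : Set a} {P : Pred A ℓ} (P? : Decidable P) {n} (f : Fin n → A) →
                         length (filter P? (tabulate f)) ≡ count (does ∘ P? ∘ f)
length-filter-tabulate P? {zero}  f = refl
length-filter-tabulate P? {suc n} f with does (P? (f zero))
... | true  = cong suc (length-filter-tabulate P? (f ∘ suc))
... | false = length-filter-tabulate P? (f ∘ suc)

length-filter-cartesianProduct :
  ∀ {a b ℓ} {A : Set a} {B : Set b} {P : Pred (A × B) ℓ} (P? : Decidable P) {n m} (f : Fin n → A) (g : Fin m → B) →
  length (filter P? (cartesianProduct (tabulate f) (tabulate g))) ≡ sum (λ i → count (λ j → does (P? (f i , g j))))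
length-filter-cartesianProduct P? {zero}  f g = refl
length-filter-cartesianProduct P? {suc n} f g = begin
  length (filter P? (first ++ rest))                    ≡⟨ cong length (filter-++ P? first rest) ⟩
  length (filter P? first ++ filter P? rest)            ≡⟨ length-++ (filter P? first) ⟩
  length (filter P? first) + length (filter P? rest)
    ≡⟨ cong₂ _+_ count-first (length-filter-cartesianProduct P? (f ∘ suc) g) ⟩
  sum (λ i → count (λ j → does (P? (f i , g j))))      ∎
  where
  open ≡-Reasoning
  first = map (f zero ,_) (tabulate g)
  rest  = cartesianProduct (tabulate (f ∘ suc)) (tabulate g)
  count-first : length (filter P? first) ≡ count (λ j → does (P? (f zero , g j)))
  count-first = trans (cong (length ∘ filter P?) (map-tabulate g (f zero ,_)))
                      (length-filter-tabulate P? (λ j → f zero , g j))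

Matrix : ℕ → ℕ → Set
Matrix n m = Fin n → Fin m → Bool

rowCount : ∀ {n m} → Matrix n m → Fin n → ℕ
rowCount M i = count (M i)

colCount : ∀ {n m} → Matrix n m → Fin m → ℕ
colCount M j = count (λ i → M i j)

size : ∀ {n m} → Matrix n m → ℕ
size M = sum (rowCount M)

-- IsTotal2Dom in matrix form, see degIn-uncurry.
record Total2Dom {n m} (M : Matrix n m) : Set where
  field dominated : ∀ i j → 2 + 2 * toℕ (M i j) ≤ rowCount M i + colCount M j

open Total2Dom

size-transpose : ∀ {n m} (M : Matrix n m) → size (transpose M) ≡ size M
size-transpose M = sym (∑-comm (λ i j → toℕ (M i j)))

total2Dom-transpose : ∀ {n m} {M : Matrix n m} → Total2Dom M → Total2Dom (transpose M)
total2Dom-transpose {M = M} dom .dominated j i =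
  subst (2 + 2 * toℕ (M i j) ≤_) (+-comm (rowCount M i) (colCount M j)) (dom .dominated i j)

rowCount-full : ∀ {n m} (M : Matrix n m) i → (∀ j → M i j ≡ true) → rowCount M i ≡ m
rowCount-full {m = m} M i full =
  trans (sum-cong-≗ (λ j → cong toℕ (full j))) (trans (sum-const {m} 1) (*-identityʳ m))

heavy-rows⇒size : ∀ {n m} {M : Matrix n m} → (∀ i → 2 ≤ rowCount M i) → n * 2 ≤ size M
heavy-rows⇒size {n} {M = M} heavy = subst (_≤ size M) (sum-const {n} 2) (sum-mono-≤ heavy)

does-member? : ∀ {n m} (S : VSet n m) x → does (member? S x) ≡ S x
does-member? S x with S x
... | true  = refl
... | false = refl

card-uncurry : ∀ {n m} (M : Matrix n m) → card (uncurry M) ≡ size M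
card-uncurry M = trans (length-filter-cartesianProduct (member? (uncurry M)) (λ i → i) (λ j → j))
  (sum-cong-≗ λ i → sum-cong-≗ λ j → cong toℕ (does-member? (uncurry M) (i , j)))

adjacent-or-equal : ∀ {n m} (i i' : Fin n) (j j' : Fin m) (b : Bool) →
  toℕ (does (adj? (i , j) (i' , j')) ∧ b) + δ i i' * (δ j j' * (2 * toℕ b)) ≡ δ i i' * toℕ b + δ j j' * toℕ b
adjacent-or-equal i i' j j' b with i ≟ i' | j ≟ j' | b
... | yes _ | yes _ | true  = refl
... | yes _ | yes _ | false = refl
... | yes _ | no  _ | true  = refl
... | yes _ | no  _ | false = refl
... | no  _ | yes _ | true  = refl
... | no  _ | yes _ | false = refl
... | no  _ | no  _ | true  = refl
... | no  _ | no  _ | false = refl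

degIn-uncurry : ∀ {n m} (M : Matrix n m) i j →
                degIn (uncurry M) (i , j) + 2 * toℕ (M i j) ≡ rowCount M i + colCount M j
degIn-uncurry {n} {m} M i j = begin
  degIn (uncurry M) (i , j) + 2 * toℕ (M i j)     ≡⟨ cong₂ _+_ degIn≡∑∑ (sym ∑∑-diagonal) ⟩
  ∑∑ adjacent + ∑∑ diagonal                       ≡⟨ sym (∑∑-distrib-+ adjacent diagonal) ⟩
  ∑∑ (λ i' j' → adjacent i' j' + diagonal i' j')
    ≡⟨ sum-cong-≗ (λ i' → sum-cong-≗ (λ j' → adjacent-or-equal i i' j j' (M i' j'))) ⟩
  ∑∑ (λ i' j' → inRow i' j' + inCol i' j')        ≡⟨ ∑∑-distrib-+ inRow inCol ⟩
  ∑∑ inRow + ∑∑ inCol                             ≡⟨ cong₂ _+_ ∑∑-inRow ∑∑-inCol ⟩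
  rowCount M i + colCount M j                     ∎
  where
  open ≡-Reasoning
  ∑∑ : (Fin n → Fin m → ℕ) → ℕ
  ∑∑ f = sum (λ i' → sum (f i'))
  ∑∑-distrib-+ : ∀ f g → ∑∑ (λ i' j' → f i' j' + g i' j') ≡ ∑∑ f + ∑∑ g
  ∑∑-distrib-+ f g = trans (sum-cong-≗ (λ i' → ∑-distrib-+ (f i') (g i'))) (∑-distrib-+ (sum ∘ f) (sum ∘ g))
  adjacent diagonal inRow inCol : Fin n → Fin m → ℕ
  adjacent i' j' = toℕ (does (adj? (i , j) (i' , j')) ∧ M i' j')
  diagonal i' j' = δ i i' * (δ j j' * (2 * toℕ (M i' j')))
  inRow    i' j' = δ i i' * toℕ (M i' j')
  inCol    i' j' = δ j j' * toℕ (M i' j')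
  degIn≡∑∑ : degIn (uncurry M) (i , j) ≡ ∑∑ adjacent
  degIn≡∑∑ = trans
    (length-filter-cartesianProduct (λ y → adj? (i , j) y ×-dec member? (uncurry M) y) (λ i' → i') (λ j' → j'))
    (sum-cong-≗ λ i' → sum-cong-≗ λ j' →
      cong (λ b → toℕ (does (adj? (i , j) (i' , j')) ∧ b)) (does-member? (uncurry M) (i' , j')))
  ∑∑-diagonal : ∑∑ diagonal ≡ 2 * toℕ (M i j)
  ∑∑-diagonal = trans
    (sum-cong-≗ λ i' → trans (sym (*-distribˡ-sum (δ i i') (λ j' → δ j j' * (2 * toℕ (M i' j')))))
                              (cong (δ i i' *_) (∑-δ j (λ j' → 2 * toℕ (M i' j')))))
    (∑-δ i (λ i' → 2 * toℕ (M i' j)))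
  ∑∑-inRow : ∑∑ inRow ≡ rowCount M i
  ∑∑-inRow = trans (sum-cong-≗ λ i' → sym (*-distribˡ-sum (δ i i') (toℕ ∘ M i'))) (∑-δ i (rowCount M))
  ∑∑-inCol : ∑∑ inCol ≡ colCount M j
  ∑∑-inCol = sum-cong-≗ λ i' → ∑-δ j (toℕ ∘ M i')

isTotal2Dom⇒total2Dom : ∀ {n m} {S : VSet n m} → IsTotal2Dom S → Total2Dom (curry S)
isTotal2Dom⇒total2Dom {S = S} dom .dominated i j =
  subst (2 + 2 * toℕ (S (i , j)) ≤_) (degIn-uncurry (curry S) i j) (+-monoˡ-≤ (2 * toℕ (S (i , j))) (dom (i , j)))

total2Dom⇒isTotal2Dom : ∀ {n m} {M : Matrix n m} → Total2Dom M → IsTotal2Dom (uncurry M)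
total2Dom⇒isTotal2Dom {M = M} dom (i , j) = +-cancelʳ-≤ (2 * toℕ (M i j)) 2 (degIn (uncurry M) (i , j))
  (subst (2 + 2 * toℕ (M i j) ≤_) (sym (degIn-uncurry M i j)) (dom .dominated i j))

light-column⇒rows-nonempty : ∀ {n m} {M : Matrix n m} → Total2Dom M →
                             ∀ {j} → colCount M j ≤ 1 → ∀ i → 1 ≤ rowCount M i
light-column⇒rows-nonempty {M = M} dom {j} light i = +-cancelʳ-≤ 1 1 (rowCount M i)
  (≤-trans (m≤m+n 2 _) (≤-trans (dom .dominated i j) (+-monoʳ-≤ (rowCount M i) light)))

light-column⇒heavy-row : ∀ {n m} {M : Matrix n m} → Total2Dom M →
                         ∀ {i j} → M i j ≡ true → colCount M j ≤ 1 → 3 ≤ rowCount M i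
light-column⇒heavy-row {M = M} dom {i} {j} M-ij light = +-cancelʳ-≤ 1 3 (rowCount M i)
  (≤-trans (subst (λ b → 2 + 2 * toℕ b ≤ rowCount M i + colCount M j) M-ij (dom .dominated i j))
           (+-monoʳ-≤ (rowCount M i) light))

extend : ∀ {n m} → Matrix n m → (Fin m → Bool) → (Fin n → Bool) → Matrix (suc n) (suc m)
extend M u v zero    zero    = false
extend M u v zero    (suc j) = u j
extend M u v (suc i) zero    = v i
extend M u v (suc i) (suc j) = M i j

size-extend : ∀ {n m} (M : Matrix n m) u v → size (extend M u v) ≡ count u + (count v + size M)
size-extend M u v = cong (count u +_) (∑-distrib-+ (toℕ ∘ v) (rowCount M))

total2Dom-extend : ∀ {n m} {M : Matrix n m} {u v} → Total2Dom M →
  2 ≤ count u + count v →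
  (∀ j → 2 + 2 * toℕ (u j) ≤ toℕ (u j) + colCount M j + count u) →
  (∀ i → 2 + 2 * toℕ (v i) ≤ toℕ (v i) + rowCount M i + count v) →
  Total2Dom (extend M u v)
total2Dom-extend dom corner top left .dominated zero zero = corner
total2Dom-extend {M = M} {u} dom corner top left .dominated zero (suc j) =
  subst (2 + 2 * toℕ (u j) ≤_) (+-comm (toℕ (u j) + colCount M j) (count u)) (top j)
total2Dom-extend dom corner top left .dominated (suc i) zero = left i
total2Dom-extend {M = M} {u} {v} dom corner top left .dominated (suc i) (suc j) =
  ≤-trans (dom .dominated i j) (+-mono-≤ (m≤n+m (rowCount M i) (toℕ (v i))) (m≤n+m (colCount M j) (toℕ (u j))))

extend-heavy-columns : ∀ {n m} {M : Matrix n (suc m)} → Total2Dom M → (∀ j → 2 ≤ colCount M j) →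
                       Σ[ M' ∈ Matrix (suc n) (suc (suc m)) ] Total2Dom M' × size M' ≤ 2 + size M
extend-heavy-columns {n} {m} {M} dom heavy = extend M u v , total2Dom-extend dom corner top left , size-bound
  where
  column-zero : Σ[ i ∈ Fin n ] Σ[ j ∈ Fin n ] ¬ i ≡ j × M i zero ≡ true × M j zero ≡ true
  column-zero = 2≤count⇒∃₂ (λ i → M i zero) (heavy zero)
  q₁ q₂ : Fin n
  q₁ = proj₁ column-zero
  q₂ = proj₁ (proj₂ column-zero)
  u : Fin (suc m) → Bool
  u _ = false
  v : Fin n → Bool
  v i = does (q₁ ≟ i) ∨ does (q₂ ≟ i)
  count-u : count u ≡ 0
  count-u = sum-zero {suc m}
  2≤count-v : 2 ≤ count v
  2≤count-v = ∈₂⇒2≤count v (proj₁ (proj₂ (proj₂ column-zero)))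
    (cong (_∨ does (q₂ ≟ q₁)) (dec-true (q₁ ≟ q₁) refl))
    (trans (cong (does (q₁ ≟ q₂) ∨_) (dec-true (q₂ ≟ q₂) refl)) (∨-zeroʳ _))
  corner : 2 ≤ count u + count v
  corner = subst (λ k → 2 ≤ k + count v) (sym count-u) 2≤count-v
  top : ∀ j → 2 + 2 * toℕ (u j) ≤ toℕ (u j) + colCount M j + count u
  top j = ≤-trans (heavy j) (m≤m+n (colCount M j) (count u))
  v⊆rows : ∀ i → toℕ (v i) ≤ rowCount M i
  v⊆rows i with q₁ ≟ i | q₂ ≟ i
  ... | yes refl | _        = ∈⇒1≤count (M i) (proj₁ (proj₂ (proj₂ (proj₂ column-zero))))
  ... | no _     | yes refl = ∈⇒1≤count (M i) (proj₂ (proj₂ (proj₂ (proj₂ column-zero))))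
  ... | no _     | no _     = z≤n
  left : ∀ i → 2 + 2 * toℕ (v i) ≤ toℕ (v i) + rowCount M i + count v
  left i = ≤-trans (2+2*x≤x+y+2 (v⊆rows i)) (+-monoʳ-≤ (toℕ (v i) + rowCount M i) 2≤count-v)
  size-bound : size (extend M u v) ≤ 2 + size M
  size-bound = begin
    size (extend M u v)           ≡⟨ size-extend M u v ⟩
    count u + (count v + size M)  ≡⟨ cong (_+ (count v + size M)) count-u ⟩
    count v + size M              ≤⟨ +-monoˡ-≤ (size M) (count-pair≤2 q₁ q₂) ⟩
    2 + size M                    ∎
    where open ≤-Reasoning

extend-heavy-rows : ∀ {n m} {M : Matrix (suc n) m} → Total2Dom M → (∀ i → 2 ≤ rowCount M i) →
                    Σ[ M' ∈ Matrix (suc (suc n)) (suc m) ] Total2Dom M' × size M' ≤ 2 + size M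
extend-heavy-rows {M = M} dom heavy with extend-heavy-columns (total2Dom-transpose dom) heavy
... | M' , dom' , size-bound =
  transpose M' , total2Dom-transpose dom' ,
  subst₂ (λ s t → s ≤ 2 + t) (sym (size-transpose M')) (size-transpose M) size-bound

new-line-singleton : ∀ {n} (w : Fin n → ℕ) {k} → (∀ i → 1 ≤ w i) → 2 ≤ w k →
                     ∀ i → 2 + 2 * toℕ (does (k ≟ i)) ≤ toℕ (does (k ≟ i)) + w i + count (λ i → does (k ≟ i))
new-line-singleton w {k} nonempty heavy i rewrite count-singleton k with k ≟ i
... | yes refl = s≤s (+-monoˡ-≤ 1 heavy)
... | no _     = +-monoˡ-≤ 1 (nonempty i)

extend-light-lines : ∀ {n m} {M : Matrix n m} → Total2Dom M →
                     ∀ {i₀ j₀} → rowCount M i₀ ≤ 1 → colCount M j₀ ≤ 1 →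
                     Σ[ M' ∈ Matrix (suc n) (suc m) ] Total2Dom M' × size M' ≤ 2 + size M
extend-light-lines {n} {m} {M} dom {i₀} {j₀} light-row light-col =
  extend M u v , total2Dom-extend dom corner top left , ≤-reflexive size-eq
  where
  rows-nonempty : ∀ i → 1 ≤ rowCount M i
  rows-nonempty = light-column⇒rows-nonempty dom light-col
  cols-nonempty : ∀ j → 1 ≤ colCount M j
  cols-nonempty = light-column⇒rows-nonempty (total2Dom-transpose dom) light-row
  q-entry : ∃ λ q → M q j₀ ≡ true
  q-entry = 1≤count⇒∃ (λ i → M i j₀) (cols-nonempty j₀)
  p-entry : ∃ λ p → M i₀ p ≡ true
  p-entry = 1≤count⇒∃ (M i₀) (rows-nonempty i₀)
  u : Fin m → Bool
  u j = does (proj₁ p-entry ≟ j)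
  v : Fin n → Bool
  v i = does (proj₁ q-entry ≟ i)
  corner : 2 ≤ count u + count v
  corner = ≤-reflexive (sym (cong₂ _+_ (count-singleton (proj₁ p-entry)) (count-singleton (proj₁ q-entry))))
  top : ∀ j → 2 + 2 * toℕ (u j) ≤ toℕ (u j) + colCount M j + count u
  top = new-line-singleton (colCount M) cols-nonempty
    (≤-trans (n≤1+n 2) (light-column⇒heavy-row (total2Dom-transpose dom) (proj₂ p-entry) light-row))
  left : ∀ i → 2 + 2 * toℕ (v i) ≤ toℕ (v i) + rowCount M i + count v
  left = new-line-singleton (rowCount M) rows-nonempty
    (≤-trans (n≤1+n 2) (light-column⇒heavy-row dom (proj₂ q-entry) light-col))
  size-eq : size (extend M u v) ≡ 2 + size M
  size-eq = trans (size-extend M u v)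
    (cong₂ (λ a b → a + (b + size M)) (count-singleton (proj₁ p-entry)) (count-singleton (proj₁ q-entry)))

upper : ∀ {n m} {M : Matrix (suc n) (suc m)} → Total2Dom M →
        Σ[ M' ∈ Matrix (suc (suc n)) (suc (suc m)) ] Total2Dom M' × size M' ≤ 2 + size M
upper {M = M} dom with all? (λ j → 2 ≤? colCount M j) | all? (λ i → 2 ≤? rowCount M i)
... | yes heavy-cols | _              = extend-heavy-columns dom heavy-cols
... | no _           | yes heavy-rows = extend-heavy-rows dom heavy-rows
... | no ¬heavy-cols | no ¬heavy-rows =
  extend-light-lines dom (proj₂ (¬all-heavy⇒∃-light (rowCount M) ¬heavy-rows))
                         (proj₂ (¬all-heavy⇒∃-light (colCount M) ¬heavy-cols))

twoRows : ∀ {n m} → Matrix (suc (suc n)) m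
twoRows zero          _ = true
twoRows (suc zero)    _ = true
twoRows (suc (suc _)) _ = false

size-twoRows : ∀ {n m} → size (twoRows {n} {m}) ≡ 2 * m
size-twoRows {n} {m} = begin
  full + (full + sum (λ i → rowCount (twoRows {n} {m}) (suc (suc i))))
    ≡⟨ cong (λ k → full + (full + k)) (trans (sum-cong-≗ {n} (λ _ → sum-zero {m})) (sum-zero {n})) ⟩
  full + (full + 0)
    ≡⟨ cong (λ k → k + (k + 0)) (rowCount-full (twoRows {n} {m}) zero (λ _ → refl)) ⟩
  2 * m ∎
  where
  open ≡-Reasoning
  full : ℕ
  full = rowCount (twoRows {n} {m}) zero

total2Dom-twoRows : ∀ {n m} → 2 ≤ m → Total2Dom (twoRows {n} {m})
total2Dom-twoRows {n} {m} 2≤m .dominated i j =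
  subst (2 + 2 * toℕ (twoRows {n} {m} i j) ≤_) (cong (rowCount (twoRows {n} {m}) i +_) (sym colCount≡2)) (bound i)
  where
  colCount≡2 : colCount (twoRows {n} {m}) j ≡ 2
  colCount≡2 = cong (λ k → 1 + (1 + k)) (sum-zero {n})
  full-row : ∀ i → (∀ j → twoRows {n} {m} i j ≡ true) → 2 + 2 * 1 ≤ rowCount (twoRows {n} {m}) i + 2
  full-row i full = subst (λ k → 4 ≤ k + 2) (sym (rowCount-full (twoRows {n} {m}) i full)) (+-monoˡ-≤ 2 2≤m)
  bound : ∀ i → 2 + 2 * toℕ (twoRows i j) ≤ rowCount (twoRows {n} {m}) i + 2
  bound zero          = full-row zero (λ _ → refl)
  bound (suc zero)    = full-row (suc zero) (λ _ → refl)
  bound (suc (suc i)) = m≤n+m 2 _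

twoLines-below : ∀ {n m b} → 2 * suc (suc m) < b ⊎ 2 * suc (suc n) < b →
                 Σ[ M ∈ Matrix (suc (suc n)) (suc (suc m)) ] Total2Dom M × size M < b
twoLines-below {n} {m} {b} (inj₁ rows-fit) =
  twoRows , total2Dom-twoRows {n} (s≤s (s≤s z≤n)) , subst (_< b) (sym (size-twoRows {n} {suc (suc m)})) rows-fit
twoLines-below {n} {m} {b} (inj₂ cols-fit) =
  transpose twoRows , total2Dom-transpose (total2Dom-twoRows {m} (s≤s (s≤s z≤n))) ,
  subst (_< b) (sym (trans (size-transpose (twoRows {m} {suc (suc n)})) (size-twoRows {m} {suc (suc n)}))) cols-fit

heavy-rows⇒twoColumns-fit : ∀ {n m} {M : Matrix (suc (suc (suc n))) m} → (∀ i → 2 ≤ rowCount M i) →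
                            2 * suc (suc n) < size M
heavy-rows⇒twoColumns-fit {n} {M = M} heavy =
  ≤-trans (n≤1+n _) (≤-trans (≤-reflexive (identity n)) (heavy-rows⇒size {M = M} heavy))
  where
  identity : ∀ n → suc (suc (2 * suc (suc n))) ≡ suc (suc (suc n)) * 2
  identity = solve-∀

size-bound⇒twoLines-fit : ∀ {n m b} → suc (suc (suc n)) + suc (suc (suc m)) ≤ b + 1 →
                          2 * suc (suc m) < b ⊎ 2 * suc (suc n) < b
size-bound⇒twoLines-fit {n} {m} {b} large = Sum.map fit-m fit-n (ℕ.≤-total m n)
  where
  doubled : ∀ k → suc (2 * suc (suc k)) + 1 ≡ suc (suc (suc k)) + suc (suc (suc k))
  doubled = solve-∀
  fit-m : m ≤ n → 2 * suc (suc m) < b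
  fit-m m≤n = +-cancelʳ-≤ 1 _ b
    (≤-trans (≤-reflexive (doubled m)) (≤-trans (+-monoˡ-≤ (3 + m) (s≤s (s≤s (s≤s m≤n)))) large))
  fit-n : n ≤ m → 2 * suc (suc n) < b
  fit-n n≤m = +-cancelʳ-≤ 1 _ b
    (≤-trans (≤-reflexive (doubled n)) (≤-trans (+-monoʳ-≤ (3 + n) (s≤s (s≤s (s≤s n≤m)))) large))

Mergeable : ∀ {n m} → Matrix n m → Fin n → Fin m → Fin m → Fin n → Set
Mergeable M r c s q = rowCount M r ≡ 1 × M r c ≡ true × colCount M s ≡ 1 × M q s ≡ true × M q c ≡ false

mergeable? : ∀ {n m} (M : Matrix n m) r c s q → Dec (Mergeable M r c s q)
mergeable? M r c s q =
  rowCount M r ℕ.≟ 1 ×-dec M r c Bool.≟ true ×-dec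
  colCount M s ℕ.≟ 1 ×-dec M q s Bool.≟ true ×-dec M q c Bool.≟ false

-- Row r and column c are deleted, and the other points of column c move to column s; they land on
-- empty cells because column s meets only row q, and M q c ≡ false.
module Merge {n m} (M : Matrix (suc n) (suc m)) {r q : Fin (suc n)} {c s : Fin (suc m)}
             (leaf-row : rowCount M r ≡ 1) (M-rc : M r c ≡ true)
             (leaf-col : colCount M s ≡ 1) (M-qs : M q s ≡ true) (M-qc : M q c ≡ false) where

  merged : Matrix n m
  merged i j = M (punchIn r i) (punchIn c j) ∨ (does (s ≟ punchIn c j) ∧ M (punchIn r i) c)

  in-column-s⇒q : ∀ {i} → M i s ≡ true → i ≡ q
  in-column-s⇒q M-is = count≡1⇒unique (λ i → M i s) leaf-col M-is M-qs

  r≢q : ¬ r ≡ q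
  r≢q refl with () ← trans (sym M-rc) M-qc

  c≢s : ¬ c ≡ s
  c≢s refl = r≢q (in-column-s⇒q M-rc)

  count-s : count (λ j → does (s ≟ punchIn c j)) ≡ 1
  count-s = begin
    count (λ j → does (s ≟ punchIn c j))
      ≡⟨ cong (λ b → toℕ b + count (λ j → does (s ≟ punchIn c j))) (sym (dec-false (s ≟ c) (c≢s ∘ sym))) ⟩
    δ s c + count (λ j → does (s ≟ punchIn c j))  ≡⟨ sym (sum-remove {i = c} (δ s)) ⟩
    count (λ j → does (s ≟ j))                    ≡⟨ count-singleton s ⟩
    1                                             ∎
    where open ≡-Reasoning

  toℕ-merged : ∀ i j →
    toℕ (merged i j) ≡ toℕ (M (punchIn r i) (punchIn c j)) + toℕ (M (punchIn r i) c) * δ s (punchIn c j)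
  toℕ-merged i j = toℕ-∨-∧ _ _ _ λ M-ij s≡j →
    let M-is = subst (λ y → M (punchIn r i) y ≡ true) (sym (does≡true⇒ (s ≟ punchIn c j) s≡j)) M-ij
    in subst (λ x → M x c ≡ false) (sym (in-column-s⇒q M-is)) M-qc

  rowCount-merged : ∀ i → rowCount merged i ≡ rowCount M (punchIn r i)
  rowCount-merged i = begin
    rowCount merged i                                    ≡⟨ sum-cong-≗ (toℕ-merged i) ⟩
    sum (λ j → rest j + k * δ s (punchIn c j))           ≡⟨ ∑-distrib-+ rest (λ j → k * δ s (punchIn c j)) ⟩
    sum rest + sum (λ j → k * δ s (punchIn c j))         ≡⟨ cong (sum rest +_) (sym (*-distribˡ-sum k (δ s ∘ punchIn c))) ⟩
    sum rest + k * count (λ j → does (s ≟ punchIn c j))  ≡⟨ cong (λ t → sum rest + k * t) count-s ⟩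
    sum rest + k * 1                                     ≡⟨ cong (sum rest +_) (*-identityʳ k) ⟩
    sum rest + k                                         ≡⟨ +-comm (sum rest) k ⟩
    k + sum rest                                         ≡⟨ sym (sum-remove {i = c} (toℕ ∘ M (punchIn r i))) ⟩
    rowCount M (punchIn r i)                             ∎
    where
    open ≡-Reasoning
    k : ℕ
    k = toℕ (M (punchIn r i) c)
    rest : Fin m → ℕ
    rest j = toℕ (M (punchIn r i) (punchIn c j))

  size-merged : size merged < size M
  size-merged = begin-strict
    size merged                                  ≡⟨ sum-cong-≗ rowCount-merged ⟩
    sum (rowCount M ∘ punchIn r)                 <⟨ ≤-refl ⟩
    1 + sum (rowCount M ∘ punchIn r)             ≡⟨ cong (_+ sum (rowCount M ∘ punchIn r)) (sym leaf-row) ⟩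
    rowCount M r + sum (rowCount M ∘ punchIn r)  ≡⟨ sym (sum-remove {i = r} (rowCount M)) ⟩
    size M                                       ∎
    where open ≤-Reasoning

  colCount-without-r : ∀ {j} → ¬ j ≡ c → sum (λ i → toℕ (M (punchIn r i) j)) ≡ colCount M j
  colCount-without-r {j} j≢c =
    sym (trans (sum-remove {i = r} (λ i → toℕ (M i j)))
               (cong (λ b → toℕ b + sum (λ i → toℕ (M (punchIn r i) j))) M-rj))
    where
    M-rj : M r j ≡ false
    M-rj = ¬-not (λ M-rj → j≢c (count≡1⇒unique (M r) leaf-row M-rj M-rc))

  colCount-merged : ∀ j → colCount merged j ≡
    sum (λ i → toℕ (M (punchIn r i) (punchIn c j))) + count (λ i → M (punchIn r i) c) * δ s (punchIn c j)
  colCount-merged j = trans (sum-cong-≗ (λ i → toℕ-merged i j))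
    (trans (∑-distrib-+ (λ i → toℕ (M (punchIn r i) (punchIn c j))) _)
           (cong (sum (λ i → toℕ (M (punchIn r i) (punchIn c j))) +_)
                 (sym (*-distribʳ-sum (δ s (punchIn c j)) (λ i → toℕ (M (punchIn r i) c))))))

  colCount≤colCount-merged : ∀ j → colCount M (punchIn c j) ≤ colCount merged j
  colCount≤colCount-merged j = begin
    colCount M (punchIn c j)                         ≡⟨ sym (colCount-without-r (punchInᵢ≢i c j)) ⟩
    sum (λ i → toℕ (M (punchIn r i) (punchIn c j)))  ≤⟨ m≤m+n _ _ ⟩
    _                                                ≡⟨ sym (colCount-merged j) ⟩
    colCount merged j                                ∎
    where open ≤-Reasoning

  colCount-merged-s : ∀ {j} → s ≡ punchIn c j → colCount merged j ≡ colCount M c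
  colCount-merged-s {j} s≡j = begin
    colCount merged j
      ≡⟨ colCount-merged j ⟩
    sum (λ i → toℕ (M (punchIn r i) (punchIn c j))) + moved * δ s (punchIn c j)
      ≡⟨ cong₂ (λ a b → a + moved * toℕ b) (colCount-without-r (punchInᵢ≢i c j)) (dec-true (s ≟ punchIn c j) s≡j) ⟩
    colCount M (punchIn c j) + moved * 1
      ≡⟨ cong₂ _+_ (trans (cong (colCount M) (sym s≡j)) leaf-col) (*-identityʳ moved) ⟩
    1 + moved
      ≡⟨ cong (λ b → toℕ b + moved) (sym M-rc) ⟩
    toℕ (M r c) + moved
      ≡⟨ sym (sum-remove {i = r} (λ i → toℕ (M i c))) ⟩
    colCount M c ∎
    where
    open ≡-Reasoning
    moved : ℕ
    moved = count (λ i → M (punchIn r i) c)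

  merged-source : ∀ i j →
    merged i j ≡ M (punchIn r i) (punchIn c j) ⊎ (s ≡ punchIn c j × merged i j ≡ M (punchIn r i) c)
  merged-source i j with M (punchIn r i) (punchIn c j) | s ≟ punchIn c j
  ... | true  | _       = inj₁ refl
  ... | false | yes s≡j = inj₂ (s≡j , refl)
  ... | false | no _    = inj₁ refl

  total2Dom-merged : Total2Dom M → Total2Dom merged
  total2Dom-merged dom .dominated i j with merged-source i j
  ... | inj₁ kept = subst (λ b → 2 + 2 * toℕ b ≤ rowCount merged i + colCount merged j) (sym kept)
    (≤-trans (dom .dominated (punchIn r i) (punchIn c j))
             (+-mono-≤ (≤-reflexive (sym (rowCount-merged i))) (colCount≤colCount-merged j)))
  ... | inj₂ (s≡j , moved) =
    subst₂ (λ b t → 2 + 2 * toℕ b ≤ t) (sym moved) (sym (cong₂ _+_ (rowCount-merged i) (colCount-merged-s s≡j)))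
      (dom .dominated (punchIn r i) c)

merge : ∀ {n m} {M : Matrix (suc n) (suc m)} → Total2Dom M → ∀ {r c s q} → Mergeable M r c s q →
        Σ[ M' ∈ Matrix n m ] Total2Dom M' × size M' < size M
merge {M = M} dom (leaf-row , M-rc , leaf-col , M-qs , M-qc) = merged , total2Dom-merged dom , size-merged
  where open Merge M leaf-row M-rc leaf-col M-qs M-qc

LeavesLinked : ∀ {n m} → Matrix n m → Set
LeavesLinked M = ∀ {r c s q} → rowCount M r ≡ 1 → M r c ≡ true → colCount M s ≡ 1 → M q s ≡ true → M q c ≡ true

leavesLinked-transpose : ∀ {n m} {M : Matrix n m} → LeavesLinked M → LeavesLinked (transpose M)
leavesLinked-transpose linked leaf-r M-rc leaf-s M-qs = linked leaf-s M-qs leaf-r M-rc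

¬mergeable⇒leavesLinked : ∀ {n m} {M : Matrix n m} →
                          ¬ (∃ λ r → ∃ λ c → ∃ λ s → ∃ λ q → Mergeable M r c s q) → LeavesLinked M
¬mergeable⇒leavesLinked ¬mergeable {r} {c} {s} {q} leaf-r M-rc leaf-s M-qs =
  ¬-not λ M-qc → ¬mergeable (r , c , s , q , leaf-r , M-rc , leaf-s , M-qs , M-qc)

-- In a row meeting a leaf column, LeavesLinked puts a point in every column meeting a leaf row,
-- and such columns are not leaves; this bounds the row from below (row-bound). Summing over rows,
-- and then over columns via transpose, gives leaf-count-arithmetic its two inequalities.
module LeafCount {n m} (M : Matrix n m) (dom : Total2Dom M) (linked : LeavesLinked M)
                 (rows-nonempty : ∀ i → 1 ≤ rowCount M i) where

  leafRow : Fin n → Bool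
  leafRow i = does (rowCount M i ℕ.≟ 1)

  leafCol : Fin m → Bool
  leafCol j = does (colCount M j ℕ.≟ 1)

  leafColsAt : Fin n → ℕ
  leafColsAt i = count (λ j → leafCol j ∧ M i j)

  meetsLeafCol : Fin n → Bool
  meetsLeafCol i = does (1 ≤? leafColsAt i)

  meetsLeafRow : Fin m → Bool
  meetsLeafRow j = does (1 ≤? count (λ i → leafRow i ∧ M i j))

  cell-bound : ∀ {i} → 1 ≤ leafColsAt i → ∀ j → toℕ (leafCol j ∧ M i j) + toℕ (meetsLeafRow j) ≤ toℕ (M i j)
  cell-bound {i} meets j with meetsLeafRow j in meets-j
  ... | false = ≤-trans (≤-reflexive (+-identityʳ _)) (toℕ-∧ (leafCol j) (M i j))
  ... | true  = subst₂ (λ a b → toℕ (a ∧ b) + 1 ≤ toℕ b) (sym not-leaf) (sym M-ij) ≤-refl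
    where
    r-entry : ∃ λ r → leafRow r ∧ M r j ≡ true
    r-entry = 1≤count⇒∃ (λ i → leafRow i ∧ M i j) (does≡true⇒ (1 ≤? _) meets-j)
    s-entry : ∃ λ s → leafCol s ∧ M i s ≡ true
    s-entry = 1≤count⇒∃ (λ j → leafCol j ∧ M i j) meets
    leaf-r : rowCount M (proj₁ r-entry) ≡ 1
    leaf-r = does≡true⇒ (_ ℕ.≟ 1) (∧-conicalˡ _ _ (proj₂ r-entry))
    M-rj : M (proj₁ r-entry) j ≡ true
    M-rj = ∧-conicalʳ _ _ (proj₂ r-entry)
    M-ij : M i j ≡ true
    M-ij = linked leaf-r M-rj (does≡true⇒ (_ ℕ.≟ 1) (∧-conicalˡ _ _ (proj₂ s-entry)))
                              (∧-conicalʳ _ _ (proj₂ s-entry))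
    heavy-j : 3 ≤ colCount M j
    heavy-j = light-column⇒heavy-row (total2Dom-transpose dom) M-rj (≤-reflexive leaf-r)
    not-leaf : leafCol j ≡ false
    not-leaf = dec-false (colCount M j ℕ.≟ 1) λ leaf-j → case subst (3 ≤_) leaf-j heavy-j of λ { (s≤s ()) }

  row-bound : ∀ i → 2 + leafColsAt i + count meetsLeafRow * toℕ (meetsLeafCol i)
                    ≤ rowCount M i + toℕ (leafRow i) + 2 * toℕ (meetsLeafCol i)
  row-bound i with meetsLeafCol i in meets-i
  ... | true = begin
    2 + leafColsAt i + count meetsLeafRow * 1  ≡⟨ reshuffle (leafColsAt i) (count meetsLeafRow) ⟩
    leafColsAt i + count meetsLeafRow + 2      ≤⟨ +-monoˡ-≤ 2 (≤-trans points (m≤m+n _ _)) ⟩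
    rowCount M i + toℕ (leafRow i) + 2         ∎
    where
    open ≤-Reasoning
    reshuffle : ∀ a b → 2 + a + b * 1 ≡ a + b + 2
    reshuffle = solve-∀
    points : leafColsAt i + count meetsLeafRow ≤ rowCount M i
    points = ≤-trans (≤-reflexive (sym (∑-distrib-+ (λ j → toℕ (leafCol j ∧ M i j)) (toℕ ∘ meetsLeafRow))))
                     (sum-mono-≤ (cell-bound (does≡true⇒ (1 ≤? leafColsAt i) meets-i)))
  ... | false = begin
    2 + leafColsAt i + count meetsLeafRow * 0
      ≡⟨ cong₂ (λ a b → 2 + a + b) no-leaf-cols (*-zeroʳ (count meetsLeafRow)) ⟩
    2                                   ≤⟨ 2≤n+[n≡1] (rowCount M i) (rows-nonempty i) ⟩
    rowCount M i + toℕ (leafRow i)      ≡⟨ sym (+-identityʳ _) ⟩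
    rowCount M i + toℕ (leafRow i) + 0  ∎
    where
    open ≤-Reasoning
    no-leaf-cols : leafColsAt i ≡ 0
    no-leaf-cols = ℕ.n<1⇒n≡0 (≰⇒> (does≡false⇒ (1 ≤? leafColsAt i) meets-i))

  sum-leafColsAt : sum leafColsAt ≡ count leafCol
  sum-leafColsAt = trans (∑-comm (λ i j → toℕ (leafCol j ∧ M i j))) (sum-cong-≗ points-in-column)
    where
    points-in-column : ∀ j → count (λ i → leafCol j ∧ M i j) ≡ toℕ (leafCol j)
    points-in-column j with leafCol j in leaf-j
    ... | true  = does≡true⇒ (colCount M j ℕ.≟ 1) leaf-j
    ... | false = sum-zero {n}

  row-sum-bound : n * 2 + count leafCol + count meetsLeafRow * count meetsLeafCol
                  ≤ size M + count leafRow + 2 * count meetsLeafCol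
  row-sum-bound = subst₂ _≤_ sum-left sum-right (sum-mono-≤ row-bound)
    where
    sum-left : sum (λ i → 2 + leafColsAt i + count meetsLeafRow * toℕ (meetsLeafCol i))
               ≡ n * 2 + count leafCol + count meetsLeafRow * count meetsLeafCol
    sum-left = trans (∑-distrib-+ (λ i → 2 + leafColsAt i) _)
      (cong₂ _+_ (trans (∑-distrib-+ (λ _ → 2) leafColsAt) (cong₂ _+_ (sum-const {n} 2) sum-leafColsAt))
                 (sym (*-distribˡ-sum (count meetsLeafRow) (toℕ ∘ meetsLeafCol))))
    sum-right : sum (λ i → rowCount M i + toℕ (leafRow i) + 2 * toℕ (meetsLeafCol i))
                ≡ size M + count leafRow + 2 * count meetsLeafCol
    sum-right = trans (∑-distrib-+ (λ i → rowCount M i + toℕ (leafRow i)) _)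
      (cong₂ _+_ (∑-distrib-+ (rowCount M) (toℕ ∘ leafRow)) (sym (*-distribˡ-sum 2 (toℕ ∘ meetsLeafCol))))

  meetsLeafRow-nonempty : ∀ {r} → rowCount M r ≡ 1 → 1 ≤ count meetsLeafRow
  meetsLeafRow-nonempty {r} leaf-r = ∈⇒1≤count meetsLeafRow meets-c
    where
    c-entry : ∃ λ c → M r c ≡ true
    c-entry = 1≤count⇒∃ (M r) (≤-reflexive (sym leaf-r))
    meets-c : meetsLeafRow (proj₁ c-entry) ≡ true
    meets-c = dec-true (1 ≤? _) (∈⇒1≤count (λ i → leafRow i ∧ M i (proj₁ c-entry))
                                  (cong₂ _∧_ (dec-true (rowCount M r ℕ.≟ 1) leaf-r) (proj₂ c-entry)))

-- The sum of the two inequalities is n + m ≤ T + q + c - q * c, and q + c - q * c ≤ 1 for q, c ≥ 1.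
leaf-count-arithmetic : ∀ {n m T kR kC q c} → 1 ≤ q → 1 ≤ c →
  n * 2 + kC + c * q ≤ T + kR + 2 * q → m * 2 + kR + q * c ≤ T + kC + 2 * c → n + m ≤ T + 1
leaf-count-arithmetic {n} {m} {T} {kR} {kC} {suc q} {suc c} _ _ rows cols =
  ℕ.*-cancelˡ-≤ 2 (≤-trans (m≤m+n (2 * (n + m)) (2 * (q * c)))
    (+-cancelʳ-≤ K _ _ (subst₂ _≤_ (left n m kR kC q c) (right T kR kC q c) (+-mono-≤ rows cols))))
  where
  K : ℕ
  K = 2 + 2 * q + 2 * c + kR + kC
  left : ∀ n m kR kC q c → n * 2 + kC + suc c * suc q + (m * 2 + kR + suc q * suc c)
                           ≡ 2 * (n + m) + 2 * (q * c) + (2 + 2 * q + 2 * c + kR + kC)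
  left = solve-∀
  right : ∀ T kR kC q c → T + kR + 2 * suc q + (T + kC + 2 * suc c) ≡ 2 * (T + 1) + (2 + 2 * q + 2 * c + kR + kC)
  right = solve-∀

leavesLinked⇒large : ∀ {n m} {M : Matrix n m} → Total2Dom M → LeavesLinked M →
                     (∀ i → 1 ≤ rowCount M i) → (∀ j → 1 ≤ colCount M j) →
                     ∀ {r s} → rowCount M r ≡ 1 → colCount M s ≡ 1 → n + m ≤ size M + 1
leavesLinked⇒large {n} {m} {M} dom linked rows-nonempty cols-nonempty leaf-r leaf-s =
  leaf-count-arithmetic {n} {m} {size M} (Cols.meetsLeafRow-nonempty leaf-s) (Rows.meetsLeafRow-nonempty leaf-r)
    Rows.row-sum-bound cols-bound
  where
  module Rows = LeafCount M dom linked rows-nonempty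
  module Cols = LeafCount (transpose M) (total2Dom-transpose dom) (leavesLinked-transpose {M = M} linked) cols-nonempty
  cols-bound : m * 2 + count Rows.leafRow + count Rows.meetsLeafCol * count Rows.meetsLeafRow
               ≤ size M + count Rows.leafCol + 2 * count Rows.meetsLeafRow
  cols-bound = ≤-trans Cols.row-sum-bound
    (≤-reflexive (cong (λ t → t + count Rows.leafCol + 2 * count Rows.meetsLeafRow) (size-transpose M)))

lower : ∀ {n m} {M : Matrix (suc (suc (suc n))) (suc (suc (suc m)))} → Total2Dom M →
        Σ[ M' ∈ Matrix (suc (suc n)) (suc (suc m)) ] Total2Dom M' × size M' < size M
lower {n} {m} {M} dom with all? (λ j → 2 ≤? colCount M j) | all? (λ i → 2 ≤? rowCount M i)
... | yes heavy-cols | _ =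
  twoLines-below (inj₁ (subst (2 * suc (suc m) <_) (size-transpose M)
                              (heavy-rows⇒twoColumns-fit {M = transpose M} heavy-cols)))
... | no _ | yes heavy-rows = twoLines-below (inj₂ (heavy-rows⇒twoColumns-fit {M = M} heavy-rows))
... | no ¬heavy-cols | no ¬heavy-rows
  with any? (λ r → any? (λ c → any? (λ s → any? (λ q → mergeable? M r c s q))))
... | yes (_ , _ , _ , _ , mergeable) = merge dom mergeable
... | no ¬mergeable = twoLines-below (size-bound⇒twoLines-fit
        (leavesLinked⇒large dom (¬mergeable⇒leavesLinked ¬mergeable) rows-nonempty cols-nonempty leaf-i₀ leaf-j₀))
  where
  i₀-light : ∃ λ i → rowCount M i ≤ 1
  i₀-light = ¬all-heavy⇒∃-light (rowCount M) ¬heavy-rows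
  j₀-light : ∃ λ j → colCount M j ≤ 1
  j₀-light = ¬all-heavy⇒∃-light (colCount M) ¬heavy-cols
  rows-nonempty : ∀ i → 1 ≤ rowCount M i
  rows-nonempty = light-column⇒rows-nonempty dom (proj₂ j₀-light)
  cols-nonempty : ∀ j → 1 ≤ colCount M j
  cols-nonempty = light-column⇒rows-nonempty (total2Dom-transpose dom) (proj₂ i₀-light)
  leaf-i₀ : rowCount M (proj₁ i₀-light) ≡ 1
  leaf-i₀ = ℕ.≤-antisym (proj₂ i₀-light) (rows-nonempty (proj₁ i₀-light))
  leaf-j₀ : colCount M (proj₁ j₀-light) ≡ 1
  leaf-j₀ = ℕ.≤-antisym (proj₂ j₀-light) (cols-nonempty (proj₁ j₀-light))

γ-step-upper : ∀ {n m a b} → IsGamma2t (suc n) (suc m) a → IsGamma2t (suc (suc n)) (suc (suc m)) b → b ≤ 2 + a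
γ-step-upper {a = a} {b} ((S , S-dom , |S|≡a) , _) (_ , b-minimal) with upper (isTotal2Dom⇒total2Dom S-dom)
... | M' , M'-dom , size-M' = begin
  b                   ≤⟨ b-minimal (uncurry M') (total2Dom⇒isTotal2Dom M'-dom) ⟩
  card (uncurry M')   ≡⟨ card-uncurry M' ⟩
  size M'             ≤⟨ size-M' ⟩
  2 + size (curry S)  ≡⟨ cong (2 +_) (trans (sym (card-uncurry (curry S))) |S|≡a) ⟩
  2 + a               ∎
  where open ≤-Reasoning

γ-step-lower : ∀ {n m a b} → IsGamma2t (suc (suc n)) (suc (suc m)) a →
               IsGamma2t (suc (suc (suc n))) (suc (suc (suc m))) b → a < b
γ-step-lower {a = a} {b} (_ , a-minimal) ((S , S-dom , |S|≡b) , _) with lower (isTotal2Dom⇒total2Dom S-dom)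
... | M , M-dom , size-M = begin-strict
  a                 ≤⟨ a-minimal (uncurry M) (total2Dom⇒isTotal2Dom M-dom) ⟩
  card (uncurry M)  ≡⟨ card-uncurry M ⟩
  size M            <⟨ size-M ⟩
  size (curry S)    ≡⟨ trans (sym (card-uncurry (curry S))) |S|≡b ⟩
  b                 ∎
  where open ≤-Reasoning

lemma2p12 : (n m : ℕ) → 2 ≤ n → 2 ≤ m → (a b : ℕ) →
    IsGamma2t n m a → IsGamma2t (n + 1) (m + 1) b →
    a + 1 ≤ b × b ≤ a + 2
lemma2p12 _ _ (s≤s (s≤s {n = n} _)) (s≤s (s≤s {n = m} _)) a b γ-a γ-b
  rewrite ℕ.+-comm n 1 | ℕ.+-comm m 1 =
  subst (_≤ b) (+-comm 1 a) (γ-step-lower γ-a γ-b) , subst (b ≤_) (+-comm 2 a) (γ-step-upper γ-a γ-b)
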